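{- Let $w\in\mathfrak{S}_N$. If some $N$-occurrence of $3412$ in $w$, consisting of values $a,N,b,c$ appearing in this left-to-right order (so $b<c<a<N$), satisfies $c\notin\{m_k(\overline{w}):\ k\in\mathrm{newrep}(w)\}$, then $w$ has an $N$-occurrence of at least one of the patterns $45231$, $45132$.
   Context: Permutations are written in one-line notation; $s_i$ is the simple reflection interchanging $i$ and $i+1$; $\mathrm{supp}(u)$ is the set of distinct simple reflections appearing in a reduced decomposition of $u$. An occurrence of a pattern $p\in\mathfrak{S}_k$ in $w$ is a subsequence $w(i_1)\cdots w(i_k)$, $i_1<\cdots<i_k$, in the same relative order as $p$; it is an $N$-occurrence if its largest value is $N$. For $w\in\mathfrak{S}_N$, $\overline{w}\in\mathfrak{S}_{N-1}$ is obtained by deleting the letter $N$ from the one-line notation of $w$. For $u\in\mathfrak{S}_n$ and $1\le k\le n-1$, $m_k(u)=\min\{u(k+1),\dots,u(n)\}$. Let $\mathrm{newrep}(w)=\{k:\ s_k\in\mathrm{supp}(\overline{w}),\ w^{ -1}(N)\le k\}$. -}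

module Defs where

open import Data.Nat using (ℕ; zero; suc; _+_; _<_; _≤_; _⊓_; _<ᵇ_)
open import Data.Bool using (Bool; true; false)
open import Data.List using (List; []; _∷_; length; map; filter; foldl; foldr; drop; upTo)
open import Data.List.Membership.Propositional using (_∈_)
open import Data.List.Relation.Binary.Permutation.Propositional using (_↭_)
open import Data.List.Relation.Unary.All using (All)
open import Data.Product using (Σ; _×_; ∃-syntax)
open import Function.Bundles using (_⇔_)
open import Relation.Binary.PropositionalEquality using (_≡_)
open import Data.Nat.Properties using (_<?_; _≟_)
open import Relation.Nullary using (¬?)

-- Permutations are lists in one-line notation, with values 1..N.
-- Positions are 1-based.  at w i = w(i)  (0 if out of range).
at : List ℕ → ℕ → ℕ
at []       _             = 0
at (x ∷ xs) zero          = 0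
at (x ∷ xs) (suc zero)    = x
at (x ∷ xs) (suc (suc i)) = at xs (suc i)

idPerm : ℕ → List ℕ
idPerm n = map suc (upTo n)

IsPerm : ℕ → List ℕ → Set
IsPerm N w = w ↭ idPerm N

delMax : ℕ → List ℕ → List ℕ
delMax N w = filter (λ x → ¬? (x ≟ N)) w

-- right multiplication by s_k (1-based k): swap positions k and k+1
swapAt : ℕ → List ℕ → List ℕ
swapAt zero xs                         = xs
swapAt (suc zero) (x ∷ y ∷ xs)         = y ∷ x ∷ xs
swapAt (suc zero) xs                   = xs
swapAt (suc (suc k)) []                = []
swapAt (suc (suc k)) (x ∷ xs)          = x ∷ swapAt (suc k) xs

wordProd : ℕ → List ℕ → List ℕ
wordProd n word = foldl (λ v a → swapAt a v) (idPerm n) word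

-- number of inversions (= Coxeter length)
inv : List ℕ → ℕ
inv []       = 0
inv (x ∷ xs) = length (filter (λ y → y <? x) xs) + inv xs

IsReducedWord : ℕ → List ℕ → List ℕ → Set
IsReducedWord n u word =
  All (λ a → 1 ≤ a × suc a ≤ n) word × wordProd n word ≡ u × length word ≡ inv u

InSupp : ℕ → List ℕ → ℕ → Set
InSupp n u k = ∃[ word ] (IsReducedWord n u word × k ∈ word)

-- minimum of a list (0 on the empty list; only used on nonempty lists)
minL : List ℕ → ℕ
minL []       = 0
minL (x ∷ xs) = foldr _⊓_ x xs

m : List ℕ → ℕ → ℕ
m u k = minL (drop k u)

InNewrep : ℕ → List ℕ → ℕ → Set
InNewrep N w k = InSupp (N Data.Nat.∸ 1) (delMax N w) k
               × (∀ p → at w p ≡ N → p ≤ k)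

data Increasing : List ℕ → Set where
  inc[]  : Increasing []
  inc[_] : ∀ x → Increasing (x ∷ [])
  inc∷   : ∀ {x y xs} → x < y → Increasing (y ∷ xs) → Increasing (x ∷ y ∷ xs)

Occurrence : ℕ → List ℕ → List ℕ → List ℕ → Set
Occurrence N w p is =
  length is ≡ length p × Increasing is × All (λ i → 1 ≤ i × i ≤ N) is
  × (∀ a b → 1 ≤ a → a ≤ length p → 1 ≤ b → b ≤ length p →
       (at p a < at p b) ⇔ (at w (at is a) < at w (at is b)))

NOccurrence : ℕ → List ℕ → List ℕ → List ℕ → Set
NOccurrence N w p is =
  Occurrence N w p is × (∀ a → at p a ≡ length p → at w (at is a) ≡ N)

HasNOccurrence : ℕ → List ℕ → List ℕ → Set
HasNOccurrence N w p = ∃[ is ] NOccurrence N w p is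

-- Write w = Q N S c R with a in Q and b in S, and let k = |Q S|, the position just before c in
-- w̄ = Q S c R. N sits left of position k, and the inversion (a, c) across k puts s_k in the support
-- of w̄, because a reduced word avoiding s_k maps {1,…,k} onto itself. So k ∈ newrep(w), and since
-- m_k(w̄) = min(c, R) differs from c, some d < c follows c. The letters a N b c d then form 45231
-- if d < b and 45132 if b < d.

module Submission where

open import Defs
open import Data.Nat
open import Data.Nat.Properties
open import Data.List using (List; []; _∷_; _++_; [_]; length; map; filter; foldl; foldr; upTo)
open import Data.List.Properties
open import Data.List.Membership.Propositional using (_∈_; _∉_; find)
open import Data.List.Membership.Propositional.Properties using (∈-∃++; ∈-++⁺ˡ; ∈-++⁺ʳ)
open import Data.List.Membership.DecPropositional _≟_ using (_∈?_)
open import Data.List.Relation.Unary.Any using (here; there)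
open import Data.List.Relation.Unary.All as All using (All; []; _∷_)
open import Data.List.Relation.Unary.All.Properties using (++⁺; ¬Any⇒All¬; ¬All⇒Any¬) renaming (map⁺ to All-map⁺)
open import Data.List.Relation.Unary.AllPairs using (_∷_)
open import Data.List.Relation.Unary.Unique.Propositional using (Unique)
open import Data.List.Relation.Unary.Unique.Propositional.Properties
  using (Unique[x∷xs]⇒x∉xs; upTo⁺) renaming (map⁺ to Unique-map⁺)
open import Data.List.Relation.Binary.Permutation.Propositional using (_↭_; ↭-sym; ↭⇒↭ₛ)
open import Data.List.Relation.Binary.Permutation.Propositional.Properties
  using (All-resp-↭; ∈-resp-↭; ↭-length; ↭-empty-inv; drop-mid)
open import Data.Product using (∃₂; ∃-syntax; _×_; _,_; proj₁)
open import Data.Sum using (_⊎_; inj₁; inj₂; map₂)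
open import Data.Empty using (⊥-elim)
open import Function.Bundles using (_⇔_; mk⇔; Equivalence)
open import Relation.Binary.PropositionalEquality hiding ([_])
open import Relation.Nullary using (¬_; ¬?; yes; no; _×-dec_)
open import Relation.Nullary.Decidable using (True; toWitness; From-yes; from-yes)
open import Relation.Binary.Definitions using (Tri; tri<; tri≈; tri>)
import Relation.Unary
open import Data.List.Relation.Binary.Sublist.Propositional {A = ℕ} using (_⊆_; []; _∷_; _∷ʳ_; minimum; from∈)
open import Data.List.Relation.Binary.Sublist.Propositional.Properties using () renaming (++⁺ to ++⁺-⊆)
open import Data.List.Relation.Binary.Permutation.Setoid.Properties (setoid ℕ) using (Unique-resp-↭)

-- Permutations of [1..n]

idPerm-suc : ∀ n → idPerm (suc n) ≡ idPerm n ++ [ suc n ]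
idPerm-suc n = begin
  map suc (upTo (suc n))    ≡⟨ cong (map suc) (sym (upTo-∷ʳ n)) ⟩
  map suc (upTo n ++ [ n ]) ≡⟨ map-++ suc (upTo n) [ n ] ⟩
  idPerm n ++ [ suc n ]     ∎
  where open ≡-Reasoning

length-idPerm : ∀ n → length (idPerm n) ≡ n
length-idPerm n = trans (length-map suc (upTo n)) (length-upTo n)

idPerm-≤ : ∀ n → All (_≤ n) (idPerm n)
idPerm-≤ zero = []
idPerm-≤ (suc n) rewrite idPerm-suc n = ++⁺ (All.map m≤n⇒m≤1+n (idPerm-≤ n)) (≤-refl ∷ [])

idPerm-split : ∀ {k n} → k ≤ n → ∃[ ys ] idPerm n ≡ idPerm k ++ ys × All (k <_) ys
idPerm-split {k} {zero} z≤n = [] , refl , []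
idPerm-split {k} {suc n} k≤1+n with k ≟ suc n
... | yes refl = [] , sym (++-identityʳ _) , []
... | no k≢1+n with idPerm-split (≤-pred (≤∧≢⇒< k≤1+n k≢1+n))
...   | ys , eq , k<ys =
  ys ++ [ suc n ] ,
  trans (idPerm-suc n) (trans (cong (_++ [ suc n ]) eq) (++-assoc (idPerm k) ys [ suc n ])) ,
  ++⁺ k<ys (≤∧≢⇒< k≤1+n k≢1+n ∷ [])

length-perm : ∀ {n w} → IsPerm n w → length w ≡ n
length-perm {n} p = trans (↭-length p) (length-idPerm n)

Unique-perm : ∀ {n w} → IsPerm n w → Unique w
Unique-perm {n} p = Unique-resp-↭ (↭⇒↭ₛ (↭-sym p)) (Unique-map⁺ suc-injective (upTo⁺ n))

IsPerm-delete-max : ∀ {n} xs ys → IsPerm (suc n) (xs ++ suc n ∷ ys) → IsPerm n (xs ++ ys)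
IsPerm-delete-max {n} xs ys p =
  subst (xs ++ ys ↭_) (++-identityʳ (idPerm n))
    (drop-mid xs (idPerm n) (subst (xs ++ suc n ∷ ys ↭_) (idPerm-suc n) p))

Unique-++⁻ʳ : ∀ (xs : List ℕ) {ys} → Unique (xs ++ ys) → Unique ys
Unique-++⁻ʳ []       u       = u
Unique-++⁻ʳ (_ ∷ xs) (_ ∷ u) = Unique-++⁻ʳ xs u

Unique-++⇒∉ : ∀ (xs : List ℕ) {ys x} → Unique (xs ++ ys) → x ∈ xs → x ∉ ys
Unique-++⇒∉ (z ∷ xs) (z∉ ∷ _) (here refl)  x∈ys = All.lookup z∉ (∈-++⁺ʳ xs x∈ys) refl
Unique-++⇒∉ (z ∷ xs) (_ ∷ u)  (there x∈xs) x∈ys = Unique-++⇒∉ xs u x∈xs x∈ys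

-- v · (a₁ ∷ … ∷ aₗ ∷ []) = v s_{a₁} ⋯ s_{aₗ}, so that wordProd n = idPerm n ·_
infixl 6 _·_
_·_ : List ℕ → List ℕ → List ℕ
v · ws = foldl (λ u a → swapAt a u) v ws

·-++ : ∀ v ws ws′ → v · (ws ++ ws′) ≡ v · ws · ws′
·-++ v ws ws′ = foldl-++ (λ u a → swapAt a u) v ws ws′

length-swapAt : ∀ a xs → length (swapAt a xs) ≡ length xs
length-swapAt zero          xs           = refl
length-swapAt (suc zero)    []           = refl
length-swapAt (suc zero)    (x ∷ [])     = refl
length-swapAt (suc zero)    (x ∷ y ∷ xs) = refl
length-swapAt (suc (suc a)) []           = refl
length-swapAt (suc (suc a)) (x ∷ xs)     = cong suc (length-swapAt (suc a) xs)

All-swapAt : ∀ {P : ℕ → Set} a {xs} → All P xs → All P (swapAt a xs)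
All-swapAt zero          ps                 = ps
All-swapAt (suc zero)    []                 = []
All-swapAt (suc zero)    (px ∷ [])          = px ∷ []
All-swapAt (suc zero)    (px ∷ py ∷ ps)     = py ∷ px ∷ ps
All-swapAt (suc (suc a)) []                 = []
All-swapAt (suc (suc a)) (px ∷ ps)          = px ∷ All-swapAt (suc a) ps

swapAt-++ˡ : ∀ {a} L R → a < length L → swapAt a (L ++ R) ≡ swapAt a L ++ R
swapAt-++ˡ {zero}          L           R _           = refl
swapAt-++ˡ {suc zero}      (x ∷ y ∷ L) R _           = refl
swapAt-++ˡ {suc zero}      (x ∷ [])    R (s≤s ())
swapAt-++ˡ {suc (suc a)}   (x ∷ L)     R (s≤s a<∣L∣) = cong (x ∷_) (swapAt-++ˡ L R a<∣L∣)

swapAt-++ʳ : ∀ xs ys j → swapAt (suc (length xs + j)) (xs ++ ys) ≡ xs ++ swapAt (suc j) ys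
swapAt-++ʳ []       ys j = refl
swapAt-++ʳ (x ∷ xs) ys j = cong (x ∷_) (swapAt-++ʳ xs ys j)

·-++ˡ : ∀ L R ws → All (_< length L) ws → (L ++ R) · ws ≡ L · ws ++ R
·-++ˡ L R []       []       = refl
·-++ˡ L R (a ∷ ws) (a<∣L∣ ∷ ws<∣L∣) rewrite swapAt-++ˡ L R a<∣L∣ =
  ·-++ˡ (swapAt a L) R ws (subst (λ l → All (_< l) ws) (sym (length-swapAt a L)) ws<∣L∣)

·-shift : ∀ xs L ws → All (1 ≤_) ws → (xs ++ L) · map (length xs +_) ws ≡ xs ++ L · ws
·-shift xs L []          []          = refl
·-shift xs L (suc j ∷ ws) (_ ∷ ws≥1) = begin
  swapAt (length xs + suc j) (xs ++ L) · map (length xs +_) ws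
    ≡⟨ cong (λ i → swapAt i (xs ++ L) · map (length xs +_) ws) (+-suc (length xs) j) ⟩
  swapAt (suc (length xs + j)) (xs ++ L) · map (length xs +_) ws
    ≡⟨ cong (_· map (length xs +_) ws) (swapAt-++ʳ xs L j) ⟩
  (xs ++ swapAt (suc j) L) · map (length xs +_) ws
    ≡⟨ ·-shift xs (swapAt (suc j) L) ws ws≥1 ⟩
  xs ++ swapAt (suc j) L · ws ∎
  where open ≡-Reasoning

-- s_k s_{k-1} ⋯ s_1 : moves the last of k+1 letters to the front
moveToFront : ℕ → List ℕ
moveToFront zero    = []
moveToFront (suc k) = map suc (moveToFront k) ++ [ 1 ]

length-moveToFront : ∀ k → length (moveToFront k) ≡ k
length-moveToFront zero    = refl
length-moveToFront (suc k) = begin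
  length (map suc (moveToFront k) ++ [ 1 ]) ≡⟨ length-++ (map suc (moveToFront k)) ⟩
  length (map suc (moveToFront k)) + 1      ≡⟨ cong (_+ 1) (length-map suc (moveToFront k)) ⟩
  length (moveToFront k) + 1                ≡⟨ cong (_+ 1) (length-moveToFront k) ⟩
  k + 1                                     ≡⟨ +-comm k 1 ⟩
  suc k                                     ∎
  where open ≡-Reasoning

moveToFront-bounded : ∀ k → All (λ a → 1 ≤ a × a ≤ k) (moveToFront k)
moveToFront-bounded zero    = []
moveToFront-bounded (suc k) =
  ++⁺ (All-map⁺ (All.map (λ (_ , a≤k) → s≤s z≤n , s≤s a≤k) (moveToFront-bounded k)))
      ((s≤s z≤n , s≤s z≤n) ∷ [])

moveToFront-moves : ∀ ys n → (ys ++ [ n ]) · moveToFront (length ys) ≡ n ∷ ys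
moveToFront-moves []       n = refl
moveToFront-moves (y ∷ ys) n = begin
  (y ∷ ys ++ [ n ]) · (map suc (moveToFront (length ys)) ++ [ 1 ])
    ≡⟨ ·-++ (y ∷ ys ++ [ n ]) (map suc (moveToFront (length ys))) [ 1 ] ⟩
  swapAt 1 ((y ∷ ys ++ [ n ]) · map suc (moveToFront (length ys)))
    ≡⟨ cong (swapAt 1) (·-shift [ y ] (ys ++ [ n ]) _ (All.map proj₁ (moveToFront-bounded (length ys)))) ⟩
  swapAt 1 (y ∷ (ys ++ [ n ]) · moveToFront (length ys))
    ≡⟨ cong (λ v → swapAt 1 (y ∷ v)) (moveToFront-moves ys n) ⟩
  n ∷ y ∷ ys ∎
  where open ≡-Reasoning

-- Existence of reduced words

filter-++-reject : ∀ {P : ℕ → Set} (P? : Relation.Unary.Decidable P) xs {n} ys → ¬ P n →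
                   filter P? (xs ++ n ∷ ys) ≡ filter P? (xs ++ ys)
filter-++-reject P? xs {n} ys ¬Pn = begin
  filter P? (xs ++ n ∷ ys)            ≡⟨ filter-++ P? xs (n ∷ ys) ⟩
  filter P? xs ++ filter P? (n ∷ ys)  ≡⟨ cong (filter P? xs ++_) (filter-reject P? ¬Pn) ⟩
  filter P? xs ++ filter P? ys        ≡⟨ filter-++ P? xs ys ⟨
  filter P? (xs ++ ys)                ∎
  where open ≡-Reasoning

inv-insert-max : ∀ n xs ys → All (_< n) (xs ++ ys) → inv (xs ++ n ∷ ys) ≡ inv (xs ++ ys) + length ys
inv-insert-max n [] ys ys<n = begin
  length (filter (_<? n) ys) + inv ys ≡⟨ cong (λ l → length l + inv ys) (filter-all (_<? n) ys<n) ⟩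
  length ys + inv ys                  ≡⟨ +-comm (length ys) (inv ys) ⟩
  inv ys + length ys                  ∎
  where open ≡-Reasoning
inv-insert-max n (x ∷ xs) ys (x<n ∷ xs++ys<n) = begin
  length (filter (_<? x) (xs ++ n ∷ ys)) + inv (xs ++ n ∷ ys)
    ≡⟨ cong₂ (λ l i → length l + i) (filter-++-reject (_<? x) xs ys (<⇒≯ x<n))
                                     (inv-insert-max n xs ys xs++ys<n) ⟩
  length (filter (_<? x) (xs ++ ys)) + (inv (xs ++ ys) + length ys)
    ≡⟨ +-assoc (length (filter (_<? x) (xs ++ ys))) (inv (xs ++ ys)) (length ys) ⟨
  inv (x ∷ xs ++ ys) + length ys
    ∎
  where open ≡-Reasoning

IsReducedWord-insert-max : ∀ {n} xs ys ws → IsPerm n (xs ++ ys) → IsReducedWord n (xs ++ ys) ws →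
  IsReducedWord (suc n) (xs ++ suc n ∷ ys) (ws ++ map (length xs +_) (moveToFront (length ys)))
IsReducedWord-insert-max {n} xs ys ws p (ws-bounded , ws-product , ws-length) =
  ++⁺ (All.map (λ (1≤a , a<n) → 1≤a , m≤n⇒m≤1+n a<n) ws-bounded) shift-bounded ,
  product , length-eq
  where
  shift : List ℕ
  shift = map (length xs +_) (moveToFront (length ys))

  ∣xs∣+∣ys∣≡n : length xs + length ys ≡ n
  ∣xs∣+∣ys∣≡n = trans (sym (length-++ xs)) (length-perm p)

  shift-bounded : All (λ a → 1 ≤ a × suc a ≤ suc n) shift
  shift-bounded = All-map⁺ (All.map
    (λ {j} (1≤j , j≤∣ys∣) → ≤-trans 1≤j (m≤n+m j (length xs)) ,
                            s≤s (subst (length xs + j ≤_) ∣xs∣+∣ys∣≡n (+-monoʳ-≤ (length xs) j≤∣ys∣)))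
    (moveToFront-bounded (length ys)))

  ws<n : All (_< length (idPerm n)) ws
  ws<n = All.map (λ {a} (_ , a<n) → subst (a <_) (sym (length-idPerm n)) a<n) ws-bounded

  product : idPerm (suc n) · (ws ++ shift) ≡ xs ++ suc n ∷ ys
  product = begin
    idPerm (suc n) · (ws ++ shift)            ≡⟨ ·-++ (idPerm (suc n)) ws shift ⟩
    idPerm (suc n) · ws · shift               ≡⟨ cong (λ v → v · ws · shift) (idPerm-suc n) ⟩
    (idPerm n ++ [ suc n ]) · ws · shift      ≡⟨ cong (_· shift) (·-++ˡ (idPerm n) [ suc n ] ws ws<n) ⟩
    (idPerm n · ws ++ [ suc n ]) · shift      ≡⟨ cong (λ v → (v ++ [ suc n ]) · shift) ws-product ⟩
    ((xs ++ ys) ++ [ suc n ]) · shift         ≡⟨ cong (_· shift) (++-assoc xs ys [ suc n ]) ⟩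
    (xs ++ ys ++ [ suc n ]) · shift
      ≡⟨ ·-shift xs (ys ++ [ suc n ]) _ (All.map proj₁ (moveToFront-bounded (length ys))) ⟩
    xs ++ (ys ++ [ suc n ]) · moveToFront (length ys) ≡⟨ cong (xs ++_) (moveToFront-moves ys (suc n)) ⟩
    xs ++ suc n ∷ ys                          ∎
    where open ≡-Reasoning

  xs++ys<1+n : All (_< suc n) (xs ++ ys)
  xs++ys<1+n = All-resp-↭ (↭-sym p) (All.map s≤s (idPerm-≤ n))

  length-eq : length (ws ++ shift) ≡ inv (xs ++ suc n ∷ ys)
  length-eq = begin
    length (ws ++ shift)       ≡⟨ length-++ ws ⟩
    length ws + length shift   ≡⟨ cong₂ _+_ ws-length (trans (length-map _ (moveToFront (length ys)))
                                                              (length-moveToFront (length ys))) ⟩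
    inv (xs ++ ys) + length ys ≡⟨ inv-insert-max (suc n) xs ys xs++ys<1+n ⟨
    inv (xs ++ suc n ∷ ys)     ∎
    where open ≡-Reasoning

reducedWord : ∀ n u → IsPerm n u → ∃[ ws ] IsReducedWord n u ws
reducedWord zero    u p rewrite ↭-empty-inv p = [] , [] , refl , refl
reducedWord (suc n) u p with ∈-∃++ (∈-resp-↭ (↭-sym p) 1+n∈idPerm)
  where
  1+n∈idPerm : suc n ∈ idPerm (suc n)
  1+n∈idPerm rewrite idPerm-suc n = ∈-++⁺ʳ (idPerm n) (here refl)
... | xs , ys , refl with reducedWord n (xs ++ ys) (IsPerm-delete-max xs ys p)
... | ws , rw = _ , IsReducedWord-insert-max xs ys ws (IsPerm-delete-max xs ys p) rw

-- The support of a permutation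

-- v maps {1,…,k} onto itself
data FixesPrefix (k : ℕ) : List ℕ → Set where
  fixes : ∀ xs ys → length xs ≡ k → All (_≤ k) xs → All (k <_) ys → FixesPrefix k (xs ++ ys)

FixesPrefix-idPerm : ∀ {k n} → k ≤ n → FixesPrefix k (idPerm n)
FixesPrefix-idPerm {k} k≤n with idPerm-split k≤n
... | ys , eq , k<ys = subst (FixesPrefix k) (sym eq) (fixes (idPerm k) ys (length-idPerm k) (idPerm-≤ k) k<ys)

FixesPrefix-swapAt : ∀ {k a v} → a ≢ k → FixesPrefix k v → FixesPrefix k (swapAt a v)
FixesPrefix-swapAt {a = a} a≢k (fixes xs ys refl xs≤k k<ys) with <-cmp a (length xs)
... | tri< a<k _ _ = subst (FixesPrefix _) (sym (swapAt-++ˡ xs ys a<k))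
                       (fixes (swapAt a xs) ys (length-swapAt a xs) (All-swapAt a xs≤k) k<ys)
... | tri≈ _ a≡k _ = ⊥-elim (a≢k a≡k)
... | tri> _ _ k<a with m≤n⇒∃[o]m+o≡n k<a
...   | j , refl = subst (FixesPrefix _) (sym (swapAt-++ʳ xs ys j))
                     (fixes xs (swapAt (suc j) ys) refl xs≤k (All-swapAt (suc j) k<ys))

FixesPrefix-· : ∀ {k v} ws → k ∉ ws → FixesPrefix k v → FixesPrefix k (v · ws)
FixesPrefix-· []       _    fp = fp
FixesPrefix-· (a ∷ ws) k∉ws fp =
  FixesPrefix-· ws (λ k∈ws → k∉ws (there k∈ws)) (FixesPrefix-swapAt (λ a≡k → k∉ws (here (sym a≡k))) fp)

++-cancel-length : ∀ (xs X : List ℕ) {ys Y} → xs ++ ys ≡ X ++ Y → length xs ≡ length X → xs ≡ X × ys ≡ Y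
++-cancel-length []       []       eq _ = refl , eq
++-cancel-length (x ∷ xs) (y ∷ X) eq ∣xs∣≡∣X∣ with ∷-injective eq
... | refl , eq′ with ++-cancel-length xs X eq′ (suc-injective ∣xs∣≡∣X∣)
...   | refl , refl = refl , refl

FixesPrefix-split : ∀ X Y {v} → v ≡ X ++ Y → FixesPrefix (length X) v →
                    All (_≤ length X) X × All (length X <_) Y
FixesPrefix-split X Y eq (fixes xs ys ∣xs∣≡∣X∣ xs≤k k<ys) with ++-cancel-length xs X eq ∣xs∣≡∣X∣
... | refl , refl = xs≤k , k<ys

InSupp-inversion : ∀ {n a} X c R → IsPerm n (X ++ c ∷ R) → a ∈ X → c < a → InSupp n (X ++ c ∷ R) (length X)
InSupp-inversion {n} X c R p a∈X c<a with reducedWord n _ p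
... | ws , rw@(_ , ws-product , _) with length X ∈? ws
...   | yes k∈ws = ws , rw , k∈ws
...   | no  k∉ws with FixesPrefix-split X (c ∷ R) ws-product (FixesPrefix-· ws k∉ws (FixesPrefix-idPerm k≤n))
  where
  k≤n : length X ≤ n
  k≤n = subst (length X ≤_) (trans (sym (length-++ X)) (length-perm p)) (m≤m+n (length X) _)
...     | X≤k , k<c ∷ _ = ⊥-elim (<-irrefl refl (<-trans k<c (<-≤-trans c<a (All.lookup X≤k a∈X))))

-- Positions in one-line notation

at-zero : ∀ xs → at xs 0 ≡ 0
at-zero []      = refl
at-zero (_ ∷ _) = refl

at-map : ∀ f → f 0 ≡ 0 → ∀ xs a → at (map f xs) a ≡ f (at xs a)
at-map f f0≡0 []       a             = sym f0≡0
at-map f f0≡0 (x ∷ xs) zero          = sym f0≡0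
at-map f f0≡0 (x ∷ xs) (suc zero)    = refl
at-map f f0≡0 (x ∷ xs) (suc (suc a)) = at-map f f0≡0 xs (suc a)

at-++ : ∀ zs y ys → at (zs ++ y ∷ ys) (suc (length zs)) ≡ y
at-++ []       y ys = refl
at-++ (z ∷ zs) y ys = at-++ zs y ys

at-∈ : ∀ xs {a} → 1 ≤ a → a ≤ length xs → at xs a ∈ xs
at-∈ (x ∷ xs) {suc zero}    _ _            = here refl
at-∈ (x ∷ xs) {suc (suc a)} _ (s≤s a<∣xs∣) = there (at-∈ xs (s≤s z≤n) a<∣xs∣)

at-∈-or-0 : ∀ xs a → at xs a ≡ 0 ⊎ at xs a ∈ xs
at-∈-or-0 []       a             = inj₁ refl
at-∈-or-0 (x ∷ xs) zero          = inj₁ refl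
at-∈-or-0 (x ∷ xs) (suc zero)    = inj₂ (here refl)
at-∈-or-0 (x ∷ xs) (suc (suc a)) = map₂ there (at-∈-or-0 xs (suc a))

at-position : ∀ Q {x T} p → x ∉ Q → x ∉ T → x ≢ 0 → at (Q ++ x ∷ T) p ≡ x → p ≡ suc (length Q)
at-position Q       zero          _   _   x≢0 eq = ⊥-elim (x≢0 (trans (sym eq) (at-zero (Q ++ _))))
at-position []      (suc zero)    _   _   _   _  = refl
at-position [] {T = T} (suc (suc p)) _ x∉T x≢0 eq with at-∈-or-0 T (suc p)
... | inj₁ at≡0 = ⊥-elim (x≢0 (trans (sym eq) at≡0))
... | inj₂ at∈T = ⊥-elim (x∉T (subst (_∈ T) eq at∈T))
at-position (q ∷ Q) (suc zero)    x∉Q _   _   eq = ⊥-elim (x∉Q (here (sym eq)))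
at-position (q ∷ Q) (suc (suc p)) x∉Q x∉T x≢0 eq =
  cong suc (at-position Q (suc p) (λ x∈Q → x∉Q (there x∈Q)) x∉T x≢0 eq)

Increasing-tail : ∀ {x xs} → Increasing (x ∷ xs) → Increasing xs
Increasing-tail inc[ _ ]     = inc[]
Increasing-tail (inc∷ _ inc) = inc

Increasing⇒All< : ∀ {x xs} → Increasing (x ∷ xs) → All (x <_) xs
Increasing⇒All< inc[ _ ]       = []
Increasing⇒All< (inc∷ x<y inc) = x<y ∷ All.map (<-trans x<y) (Increasing⇒All< inc)

All<⇒Increasing : ∀ {x xs} → All (x <_) xs → Increasing xs → Increasing (x ∷ xs)
All<⇒Increasing []          inc[]    = inc[ _ ]
All<⇒Increasing (x<y ∷ _)   inc      = inc∷ x<y inc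

Increasing-at-< : ∀ {L i j} → Increasing L → 1 ≤ i → i < j → j ≤ length L → at L i < at L j
Increasing-at-< {y ∷ L} {suc zero}    {suc (suc j)} inc _ _ (s≤s j<∣L∣) =
  All.lookup (Increasing⇒All< inc) (at-∈ L (s≤s z≤n) j<∣L∣)
Increasing-at-< {_ ∷ _} {suc zero}    {suc zero}    _ _ (s≤s ()) _
Increasing-at-< {y ∷ L} {suc (suc i)} {suc (suc j)} inc _ (s≤s i<j) (s≤s j<∣L∣) =
  Increasing-at-< (Increasing-tail inc) (s≤s z≤n) i<j j<∣L∣

Increasing-at-⇔ : ∀ {L i j} → Increasing L → 1 ≤ i → i ≤ length L → 1 ≤ j → j ≤ length L →
                  i < j ⇔ at L i < at L j
Increasing-at-⇔ {L} {i} {j} inc 1≤i i≤∣L∣ 1≤j j≤∣L∣ =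
  mk⇔ (λ i<j → Increasing-at-< inc 1≤i i<j j≤∣L∣) from
  where
  from : at L i < at L j → i < j
  from Li<Lj with <-cmp i j
  ... | tri< i<j _ _ = i<j
  ... | tri≈ _ refl _ = ⊥-elim (<-irrefl refl Li<Lj)
  ... | tri> _ _ j<i = ⊥-elim (<-asym Li<Lj (Increasing-at-< inc 1≤j j<i i≤∣L∣))

-- Occurrences as sublists

length-snoc : ∀ (zs : List ℕ) y → length (zs ++ [ y ]) ≡ suc (length zs)
length-snoc zs y = trans (length-++ zs) (+-comm (length zs) 1)

-- the 1-based positions in ys of the letters picked out by τ, as if ys were preceded by o letters
positions : ∀ {xs ys} → ℕ → xs ⊆ ys → List ℕ
positions o []       = []
positions o (y ∷ʳ τ) = positions (suc o) τ
positions o (_ ∷ τ)  = suc o ∷ positions (suc o) τ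

length-positions : ∀ {xs ys} o (τ : xs ⊆ ys) → length (positions o τ) ≡ length xs
length-positions o []       = refl
length-positions o (y ∷ʳ τ) = length-positions (suc o) τ
length-positions o (_ ∷ τ)  = cong suc (length-positions (suc o) τ)

weaken-offset-bounds : ∀ {o n i} → suc o < i × i ≤ suc o + n → o < i × i ≤ o + suc n
weaken-offset-bounds {o} {n} {i} (1+o<i , i≤1+o+n) =
  <-trans (n<1+n o) 1+o<i , subst (i ≤_) (sym (+-suc o n)) i≤1+o+n

positions-bounded : ∀ {xs ys} o (τ : xs ⊆ ys) → All (λ i → o < i × i ≤ o + length ys) (positions o τ)
positions-bounded o []       = []
positions-bounded o (y ∷ʳ τ) = All.map weaken-offset-bounds (positions-bounded (suc o) τ)
positions-bounded o (_ ∷ τ)  =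
  (n<1+n o , m<m+n o (s≤s z≤n)) ∷ All.map weaken-offset-bounds (positions-bounded (suc o) τ)

positions-increasing : ∀ {xs ys} o (τ : xs ⊆ ys) → Increasing (positions o τ)
positions-increasing o []       = inc[]
positions-increasing o (y ∷ʳ τ) = positions-increasing (suc o) τ
positions-increasing o (_ ∷ τ)  =
  All<⇒Increasing (All.map proj₁ (positions-bounded (suc o) τ)) (positions-increasing (suc o) τ)

at-positions : ∀ {xs ys} zs (τ : xs ⊆ ys) a → at (zs ++ ys) (at (positions (length zs) τ) a) ≡ at xs a
at-positions zs [] a = at-zero (zs ++ [])
at-positions zs (_∷ʳ_ {ys = ys} y τ) a =
  subst₂ (λ l k → at l (at (positions k τ) a) ≡ _) (∷ʳ-++ zs y ys) (length-snoc zs y)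
    (at-positions (zs ++ [ y ]) τ a)
at-positions zs (_ ∷ τ)    zero       = at-zero (zs ++ _)
at-positions zs (refl ∷ τ) (suc zero) = at-++ zs _ _
at-positions zs (_∷_ {y = y} {ys = ys} refl τ) (suc (suc a)) =
  subst₂ (λ l k → at l (at (positions k τ) (suc a)) ≡ _) (∷ʳ-++ zs y ys) (length-snoc zs y)
    (at-positions (zs ++ [ y ]) τ (suc a))

-- L lists the letters of the occurrence in increasing order
NOccurrence-sorted : ∀ {N w} L p → Increasing L → All (λ i → 1 ≤ i × i ≤ length L) p →
                     at L (length p) ≡ N → length w ≡ N → (τ : map (at L) p ⊆ w) →
                     NOccurrence N w p (positions 0 τ)
NOccurrence-sorted {N} {w} L p L-inc p-bounded L∣p∣≡N ∣w∣≡N τ =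
  (length-eq , positions-increasing 0 τ , bounded , order) , top
  where
  value : ∀ a → at w (at (positions 0 τ) a) ≡ at L (at p a)
  value a = trans (at-positions [] τ a) (at-map (at L) (at-zero L) p a)

  length-eq : length (positions 0 τ) ≡ length p
  length-eq = trans (length-positions 0 τ) (length-map (at L) p)

  bounded : All (λ i → 1 ≤ i × i ≤ N) (positions 0 τ)
  bounded = subst (λ n → All (λ i → 1 ≤ i × i ≤ n) (positions 0 τ)) ∣w∣≡N (positions-bounded 0 τ)

  order : ∀ a b → 1 ≤ a → a ≤ length p → 1 ≤ b → b ≤ length p →
          (at p a < at p b) ⇔ (at w (at (positions 0 τ) a) < at w (at (positions 0 τ) b))
  order a b 1≤a a≤∣p∣ 1≤b b≤∣p∣ with All.lookup p-bounded (at-∈ p 1≤a a≤∣p∣)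
                                    | All.lookup p-bounded (at-∈ p 1≤b b≤∣p∣)
  ... | 1≤pa , pa≤∣L∣ | 1≤pb , pb≤∣L∣ =
    subst₂ (λ x y → (at p a < at p b) ⇔ (x < y)) (sym (value a)) (sym (value b))
      (Increasing-at-⇔ L-inc 1≤pa pa≤∣L∣ 1≤pb pb≤∣L∣)

  top : ∀ a → at p a ≡ length p → at w (at (positions 0 τ) a) ≡ N
  top a pa≡∣p∣ = trans (value a) (trans (cong (at L) pa≡∣p∣) L∣p∣≡N)

⊆-split : ∀ {x xs ys} → x ∷ xs ⊆ ys → ∃₂ λ P S → ys ≡ P ++ x ∷ S × xs ⊆ S
⊆-split (y ∷ʳ τ) with ⊆-split τ
... | P , S , refl , σ = y ∷ P , S , refl , σ
⊆-split (refl ∷ τ) = [] , _ , refl , τ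

sublist-at : ∀ zs w {is} → Increasing is → All (length zs <_) is → All (_≤ length zs + length w) is →
             map (at (zs ++ w)) is ⊆ w
sublist-after-snoc : ∀ zs y w {js} → Increasing js → All (suc (length zs) <_) js →
                     All (_≤ length zs + suc (length w)) js → map (at (zs ++ y ∷ w)) js ⊆ w

sublist-at zs []      {[]}     _   _ _ = []
sublist-at zs []      {i ∷ _}  _   (∣zs∣<i ∷ _) (i≤∣zs∣+0 ∷ _) =
  ⊥-elim (<⇒≱ ∣zs∣<i (subst (i ≤_) (+-identityʳ (length zs)) i≤∣zs∣+0))
sublist-at zs (y ∷ w) {[]}     _   _ _ = minimum _
sublist-at zs (y ∷ w) {i ∷ is} inc (∣zs∣<i ∷ _) i∷is≤@(_ ∷ is≤) with i ≟ suc (length zs)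
... | yes i≡1+∣zs∣ =
  subst (λ k → at (zs ++ y ∷ w) k ≡ y) (sym i≡1+∣zs∣) (at-++ zs y w) ∷
  sublist-after-snoc zs y w (Increasing-tail inc)
    (subst (λ k → All (k <_) is) i≡1+∣zs∣ (Increasing⇒All< inc)) is≤
... | no  i≢1+∣zs∣ =
  y ∷ʳ sublist-after-snoc zs y w inc (1+∣zs∣<i ∷ All.map (<-trans 1+∣zs∣<i) (Increasing⇒All< inc)) i∷is≤
  where
  1+∣zs∣<i : suc (length zs) < i
  1+∣zs∣<i = ≤∧≢⇒< ∣zs∣<i (λ e → i≢1+∣zs∣ (sym e))

sublist-after-snoc zs y w {js} js-inc js> js≤ =
  subst (λ l → map (at l) js ⊆ w) (∷ʳ-++ zs y w)
    (sublist-at (zs ++ [ y ]) w js-inc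
      (subst (λ k → All (k <_) js) (sym (length-snoc zs y)) js>)
      (subst (λ k → All (_≤ k) js) ∣zs∣+1+∣w∣≡ js≤))
  where
  ∣zs∣+1+∣w∣≡ : length zs + suc (length w) ≡ length (zs ++ [ y ]) + length w
  ∣zs∣+1+∣w∣≡ = trans (+-suc (length zs) (length w)) (cong (_+ length w) (sym (length-snoc zs y)))

⊆-split₂ : ∀ {x y xs ys} → x ∷ y ∷ xs ⊆ ys → ∃₂ λ Q S → ys ≡ Q ++ y ∷ S × x ∈ Q × xs ⊆ S
⊆-split₂ {x} {y} τ with ⊆-split τ
... | P , S′ , refl , σ with ⊆-split σ
...   | P′ , S , refl , ρ =
  P ++ x ∷ P′ , S , sym (++-assoc P (x ∷ P′) (y ∷ S)) , ∈-++⁺ʳ P (here refl) , ρ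

NOccurrence⇒sublist : ∀ {N w p is} → length w ≡ N → NOccurrence N w p is → map (at w) is ⊆ w
NOccurrence⇒sublist {w = w} ∣w∣≡N ((_ , inc , bounded , _) , _) =
  sublist-at [] w inc (All.map proj₁ bounded)
    (All.map (λ {i} (_ , i≤N) → subst (i ≤_) (sym ∣w∣≡N) i≤N) bounded)

≤-lit : ∀ {m n} {m≤n : True (m ≤? n)} → m ≤ n
≤-lit {m≤n = m≤n} = toWitness m≤n

NOccurrence-3412 : ∀ {N w is} → length w ≡ N → NOccurrence N w (3 ∷ 4 ∷ 1 ∷ 2 ∷ []) is →
  let a = at w (at is 1) ; b = at w (at is 3) ; c = at w (at is 4) in
  a ∷ N ∷ b ∷ c ∷ [] ⊆ w × b < c × c < a × a < N
NOccurrence-3412 {is = []}                          _ ((() , _) , _)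
NOccurrence-3412 {is = _ ∷ []}                      _ ((() , _) , _)
NOccurrence-3412 {is = _ ∷ _ ∷ []}                  _ ((() , _) , _)
NOccurrence-3412 {is = _ ∷ _ ∷ _ ∷ []}              _ ((() , _) , _)
NOccurrence-3412 {is = _ ∷ _ ∷ _ ∷ _ ∷ _ ∷ _}       _ ((() , _) , _)
NOccurrence-3412 {N} {w} {is = i₁ ∷ i₂ ∷ i₃ ∷ i₄ ∷ []} ∣w∣≡N occ@((_ , _ , _ , order) , top) =
  subst (λ v → at w i₁ ∷ v ∷ at w i₃ ∷ at w i₄ ∷ [] ⊆ w) (top 2 refl) (NOccurrence⇒sublist ∣w∣≡N occ) ,
  Equivalence.to (order 3 4 ≤-lit ≤-lit ≤-lit ≤-lit) ≤-lit ,
  Equivalence.to (order 4 1 ≤-lit ≤-lit ≤-lit ≤-lit) ≤-lit ,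
  subst (at w i₁ <_) (top 2 refl) (Equivalence.to (order 1 2 ≤-lit ≤-lit ≤-lit ≤-lit) ≤-lit)

delMax-insert : ∀ {N} Q T → N ∉ Q → N ∉ T → delMax N (Q ++ N ∷ T) ≡ Q ++ T
delMax-insert {N} Q T N∉Q N∉T = begin
  filter ≢N? (Q ++ N ∷ T) ≡⟨ filter-++-reject ≢N? Q T (λ N≢N → N≢N refl) ⟩
  filter ≢N? (Q ++ T)     ≡⟨ filter-all ≢N? (++⁺ (≢N Q N∉Q) (≢N T N∉T)) ⟩
  Q ++ T                  ∎
  where
  open ≡-Reasoning
  ≢N? : Relation.Unary.Decidable (_≢ N)
  ≢N? x = ¬? (x ≟ N)
  ≢N : ∀ xs → N ∉ xs → All (_≢ N) xs
  ≢N xs N∉xs = All.map (λ N≢x x≡N → N≢x (sym x≡N)) (¬Any⇒All¬ xs N∉xs)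

m-after : ∀ X {c R} → m (X ++ c ∷ R) (length X) ≡ foldr _⊓_ c R
m-after []      = refl
m-after (_ ∷ X) = m-after X

foldr-⊓-≥ : ∀ {c} R → All (c ≤_) R → foldr _⊓_ c R ≡ c
foldr-⊓-≥     []      []          = refl
foldr-⊓-≥ {c} (x ∷ R) (c≤x ∷ c≤R) = trans (cong (x ⊓_) (foldr-⊓-≥ R c≤R)) (m≥n⇒m⊓n≡n c≤x)

newrep-before-c : ∀ {n a b c} Q S R → IsPerm (suc n) (Q ++ suc n ∷ S ++ c ∷ R) → a ∈ Q → c < a → b ∈ S →
  let w = Q ++ suc n ∷ S ++ c ∷ R ; k = length (Q ++ S) in
  InNewrep (suc n) w k × m (delMax (suc n) w) k ≡ foldr _⊓_ c R
newrep-before-c {n} {a} {b} {c} Q S R p a∈Q c<a b∈S = (supp , N-before) , m-eq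
  where
  u : Unique (Q ++ suc n ∷ S ++ c ∷ R)
  u = Unique-perm p
  N∉Q : suc n ∉ Q
  N∉Q N∈Q = Unique-++⇒∉ Q u N∈Q (here refl)
  N∉T : suc n ∉ S ++ c ∷ R
  N∉T = Unique[x∷xs]⇒x∉xs (Unique-++⁻ʳ Q u)
  w̄≡ : delMax (suc n) (Q ++ suc n ∷ S ++ c ∷ R) ≡ (Q ++ S) ++ c ∷ R
  w̄≡ = trans (delMax-insert Q (S ++ c ∷ R) N∉Q N∉T) (sym (++-assoc Q S (c ∷ R)))
  p′ : IsPerm n ((Q ++ S) ++ c ∷ R)
  p′ = subst (IsPerm n) (sym (++-assoc Q S (c ∷ R))) (IsPerm-delete-max Q (S ++ c ∷ R) p)
  supp : InSupp n (delMax (suc n) (Q ++ suc n ∷ S ++ c ∷ R)) (length (Q ++ S))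
  supp = subst (λ v → InSupp n v (length (Q ++ S))) (sym w̄≡)
           (InSupp-inversion (Q ++ S) c R p′ (∈-++⁺ˡ a∈Q) c<a)
  N-before : ∀ i → at (Q ++ suc n ∷ S ++ c ∷ R) i ≡ suc n → i ≤ length (Q ++ S)
  N-before i eq rewrite at-position Q i N∉Q N∉T (λ ()) eq =
    subst₂ _≤_ (+-comm (length Q) 1) (sym (length-++ Q)) (+-monoʳ-≤ (length Q) (1≤∣S∣ b∈S))
    where
    1≤∣S∣ : ∀ {S b} → b ∈ S → 1 ≤ length S
    1≤∣S∣ (here _)  = s≤s z≤n
    1≤∣S∣ (there _) = s≤s z≤n
  m-eq : m (delMax (suc n) (Q ++ suc n ∷ S ++ c ∷ R)) (length (Q ++ S)) ≡ foldr _⊓_ c R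
  m-eq = trans (cong (λ v → m v (length (Q ++ S))) w̄≡) (m-after (Q ++ S))

foldr-⊓≢⇒smaller : ∀ c R → foldr _⊓_ c R ≢ c → ∃[ d ] d ∈ R × d < c
foldr-⊓≢⇒smaller c R min≢c with All.all? (c ≤?_) R
... | yes c≤R = ⊥-elim (min≢c (foldr-⊓-≥ R c≤R))
... | no ¬c≤R with find (¬All⇒Any¬ (c ≤?_) R ¬c≤R)
...   | d , d∈R , c≰d = d , d∈R , ≰⇒> c≰d

45231⊎45132-of-3412 : ∀ {N w a b c} → IsPerm N w → a ∷ N ∷ b ∷ c ∷ [] ⊆ w → b < c → c < a → a < N →
  (∀ k → InNewrep N w k → ¬ (c ≡ m (delMax N w) k)) →
  HasNOccurrence N w (4 ∷ 5 ∷ 2 ∷ 3 ∷ 1 ∷ []) ⊎ HasNOccurrence N w (4 ∷ 5 ∷ 1 ∷ 3 ∷ 2 ∷ [])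
45231⊎45132-of-3412 {suc n} {w} {a} {b} {c} p τ b<c c<a a<N c≢m with ⊆-split₂ τ
... | Q , W , refl , a∈Q , τ-bcd with ⊆-split₂ τ-bcd
... | S , R , refl , b∈S , _ with newrep-before-c Q S R p a∈Q c<a b∈S
... | newrep , m≡min
    with foldr-⊓≢⇒smaller c R (λ min≡c → c≢m (length (Q ++ S)) newrep (sym (trans m≡min min≡c)))
... | d , d∈R , d<c = by-order-of-d-and-b (<-cmp d b)
  where
  bounded : ∀ p → From-yes (All.all? (λ i → (1 ≤? i) ×-dec (i ≤? 5)) p)
  bounded p = from-yes (All.all? (λ i → (1 ≤? i) ×-dec (i ≤? 5)) p)

  τ-abcd : a ∷ suc n ∷ b ∷ c ∷ d ∷ [] ⊆ Q ++ suc n ∷ S ++ c ∷ R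
  τ-abcd = ++⁺-⊆ (from∈ a∈Q) (refl ∷ ++⁺-⊆ (from∈ b∈S) (refl ∷ from∈ d∈R))

  b∉R : b ∉ R
  b∉R b∈R = Unique-++⇒∉ S unique-after-N b∈S (there b∈R)
    where
    unique-after-N : Unique (S ++ c ∷ R)
    unique-after-N = Unique-++⁻ʳ (Q ++ [ suc n ]) (subst Unique (sym (∷ʳ-++ Q (suc n) _)) (Unique-perm p))

  by-order-of-d-and-b : Tri (d < b) (d ≡ b) (b < d) →
    HasNOccurrence (suc n) w (4 ∷ 5 ∷ 2 ∷ 3 ∷ 1 ∷ []) ⊎
    HasNOccurrence (suc n) w (4 ∷ 5 ∷ 1 ∷ 3 ∷ 2 ∷ [])
  by-order-of-d-and-b (tri< d<b _ _) = inj₁ (_ ,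
    NOccurrence-sorted (d ∷ b ∷ c ∷ a ∷ suc n ∷ []) (4 ∷ 5 ∷ 2 ∷ 3 ∷ 1 ∷ [])
      (inc∷ d<b (inc∷ b<c (inc∷ c<a (inc∷ a<N inc[ _ ])))) (bounded (4 ∷ 5 ∷ 2 ∷ 3 ∷ 1 ∷ []))
      refl (length-perm p) τ-abcd)
  by-order-of-d-and-b (tri≈ _ d≡b _) = ⊥-elim (b∉R (subst (_∈ R) d≡b d∈R))
  by-order-of-d-and-b (tri> _ _ b<d) = inj₂ (_ ,
    NOccurrence-sorted (b ∷ d ∷ c ∷ a ∷ suc n ∷ []) (4 ∷ 5 ∷ 1 ∷ 3 ∷ 2 ∷ [])
      (inc∷ b<d (inc∷ d<c (inc∷ c<a (inc∷ a<N inc[ _ ])))) (bounded (4 ∷ 5 ∷ 1 ∷ 3 ∷ 2 ∷ []))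
      refl (length-perm p) τ-abcd)

proposition4p2p4 : (N : ℕ) (w : List ℕ) → IsPerm N w →
    (is : List ℕ) → NOccurrence N w (3 ∷ 4 ∷ 1 ∷ 2 ∷ []) is →
    (∀ k → InNewrep N w k → ¬ (at w (at is 4) ≡ m (delMax N w) k)) →
    HasNOccurrence N w (4 ∷ 5 ∷ 2 ∷ 3 ∷ 1 ∷ []) ⊎ HasNOccurrence N w (4 ∷ 5 ∷ 1 ∷ 3 ∷ 2 ∷ [])
proposition4p2p4 N w p is occ c≢m with NOccurrence-3412 (length-perm p) occ
... | τ , b<c , c<a , a<N = 45231⊎45132-of-3412 p τ b<c c<a a<N c≢m
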